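{- Let $f$ be the $n$-ary operation on $\mathbb{Z}_8$ given by $f=2x_1\cdots x_n\left(\sum_{i=1}^n a_ix_i^2+\sum_{i=1}^n b_ix_i+c\right)$ with $a_i,b_i\in\{0,1\}$, $c\in\{0,1,2,3\}$, and assume $a_i\ne0$ for some $i$. Then $2w_n\in C(f)$ or $2q_n\in C(f)$, where $w_n=x_1\cdots x_n(x_1^2+1)$ and $q_n=x_1^3x_2\cdots x_n$.
   Context: For an operation $g$ on $\mathbb{Z}_8$, $C(g)$ denotes the clone on $\mathbb{Z}_8$ generated by $g$, the binary addition and all unary constant operations. -}

module Defs where

open import Data.Nat using (ℕ; zero; suc; _+_; _*_)
open import Data.Nat.DivMod using (_mod_)
open import Data.Fin using (Fin; toℕ; fromℕ<)
import Data.Fin as F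
open import Data.Bool using (Bool; true; false)
open import Data.Product using (Σ)
open import Relation.Binary.PropositionalEquality using (_≡_)

ℤ₈ : Set
ℤ₈ = Fin 8

_⊕_ : ℤ₈ → ℤ₈ → ℤ₈
a ⊕ b = (toℕ a + toℕ b) mod 8

Op : ℕ → Set
Op n = (Fin n → ℤ₈) → ℤ₈

Σℕ : (n : ℕ) → (Fin n → ℕ) → ℕ
Σℕ zero    f = 0
Σℕ (suc n) f = f F.zero + Σℕ n (λ i → f (F.suc i))

Πℕ : (n : ℕ) → (Fin n → ℕ) → ℕ
Πℕ zero    f = 1
Πℕ (suc n) f = f F.zero * Πℕ n (λ i → f (F.suc i))

bit : Bool → ℕ
bit false = 0
bit true  = 1

fOp : (n : ℕ) → (Fin n → Bool) → (Fin n → Bool) → Fin 4 → Op n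
fOp n a b c x =
  (2 * Πℕ n (λ i → toℕ (x i))
     * (Σℕ n (λ i → bit (a i) * (toℕ (x i) * toℕ (x i)))
        + Σℕ n (λ i → bit (b i) * toℕ (x i))
        + toℕ c)) mod 8

-- 2wₙ = 2 x₁⋯xₙ (x₁² + 1), for n ≥ 1 (variables indexed from 0)
twoW : (n : ℕ) → Op (suc n)
twoW n x = (2 * Πℕ (suc n) (λ i → toℕ (x i))
              * (toℕ (x F.zero) * toℕ (x F.zero) + 1)) mod 8

twoQ : (n : ℕ) → Op (suc n)
twoQ n x = (2 * (toℕ (x F.zero) * toℕ (x F.zero))
              * Πℕ (suc n) (λ i → toℕ (x i))) mod 8

-- Terms of arity k over a single n-ary basic operation g, binary addition
-- and all constants; their term operations form exactly the clone C(g).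
data Term (n k : ℕ) : Set where
  var   : Fin k → Term n k
  const : ℤ₈ → Term n k
  add   : Term n k → Term n k → Term n k
  app   : (Fin n → Term n k) → Term n k

eval : ∀ {n k} → Op n → Term n k → Op k
eval g (var i)   x = x i
eval g (const a) x = a
eval g (add s t) x = eval g s x ⊕ eval g t x
eval g (app ts)  x = g (λ j → eval g (ts j) x)

_∈C_ : ∀ {n k} → Op k → Op n → Set
_∈C_ {n} {k} h g = Σ (Term n k) (λ t → ∀ x → eval g t x ≡ h x)

module Submission where

-- Substitute terms G, H in two variables X = x₁ and Y = xⱼ for two distinct variables
-- x_p, x_q of f with a_p = 1, keeping all other variables. The result evaluates to
--   r · 2gh(g² + b_p g + a_q h² + b_q h + s)      (g, h the values of G, H),
-- where r and s, the residues of the product and of the remaining part of the sum over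
-- the kept variables, do not depend on G and H. A fixed ℤ₈-linear combination of eight
-- such substitutions with affine G and H equals r · 2XY(X² + 1) whatever r, s, b_p, a_q
-- and b_q are (checked by evaluation over all values), and since XY times the kept
-- variables is x₁⋯xₙ this is 2wₙ. For n = 1, f = 2x(x² + bx + c) and an explicit
-- term for each (b, c) gives 2w₁. So in fact 2wₙ ∈ C(f) in every case.

open import Defs
open import Data.Nat using (ℕ; suc)
open import Data.Fin using (Fin)
open import Data.Bool using (Bool; true)
open import Data.Product using (Σ)
open import Data.Sum using (_⊎_)
open import Relation.Binary.PropositionalEquality using (_≡_)

open import Algebra.Properties.CommutativeSemigroup using (x∙yz≈y∙xz)
open import Data.Bool using (false)
open import Data.Fin using (zero; suc; toℕ)
open import Data.Fin.Patterns using (0F; 1F; 2F; 3F)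
open import Data.Fin.Properties using (toℕ-fromℕ<; toℕ-injective; all?) renaming (_≟_ to _≟ᶠ_)
open import Data.List using (List; []; _∷_)
open import Data.Nat using (zero; _+_; _*_; _%_; NonZero)
open import Data.Nat.DivMod using (_mod_; m%n<n; m%n%n≡m%n; %-distribˡ-+; %-distribˡ-*)
open import Data.Nat.Properties using (*-identityˡ; +-commutativeSemigroup; *-commutativeSemigroup)
open import Data.Nat.Solver using (module +-*-Solver)
open import Data.Product using (_×_; _,_)
open import Data.Sum using (inj₁; inj₂)
open import Data.Vec.Functional using (updateAt)
open import Data.Vec.Functional.Properties using (updateAt-commutes; updateAt-minimal; updateAt-id-local)
open import Relation.Binary.PropositionalEquality
  using (_≢_; _≗_; refl; sym; trans; cong; cong₂; module ≡-Reasoning)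
open import Relation.Nullary using (Dec)
open import Relation.Nullary.Decidable using (map′; _×-dec_; toWitness)

open +-*-Solver using (solve; _:+_; _:*_; _:=_; con)
open ≡-Reasoning

x+[y+z]≡y+[x+z] : ∀ x y z → x + (y + z) ≡ y + (x + z)
x+[y+z]≡y+[x+z] = x∙yz≈y∙xz +-commutativeSemigroup

x*[y*z]≡y*[x*z] : ∀ x y z → x * (y * z) ≡ y * (x * z)
x*[y*z]≡y*[x*z] = x∙yz≈y∙xz *-commutativeSemigroup

toℕ-mod : ∀ m d .{{_ : NonZero d}} → toℕ (m mod d) ≡ m % d
toℕ-mod m d = toℕ-fromℕ< (m%n<n m d)

mod-cong : ∀ m m′ d .{{_ : NonZero d}} → m % d ≡ m′ % d → m mod d ≡ m′ mod d
mod-cong m m′ d eq = toℕ-injective (trans (toℕ-mod m d) (trans eq (sym (toℕ-mod m′ d))))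

%-+-cong : ∀ m m′ n n′ d .{{_ : NonZero d}} →
           m % d ≡ m′ % d → n % d ≡ n′ % d → (m + n) % d ≡ (m′ + n′) % d
%-+-cong m m′ n n′ d eqm eqn = begin
  (m + n) % d           ≡⟨ %-distribˡ-+ m n d ⟩
  (m % d + n % d) % d   ≡⟨ cong₂ (λ u v → (u + v) % d) eqm eqn ⟩
  (m′ % d + n′ % d) % d ≡⟨ %-distribˡ-+ m′ n′ d ⟨
  (m′ + n′) % d         ∎

%-*-cong : ∀ m m′ n n′ d .{{_ : NonZero d}} →
           m % d ≡ m′ % d → n % d ≡ n′ % d → (m * n) % d ≡ (m′ * n′) % d
%-*-cong m m′ n n′ d eqm eqn = begin
  (m * n) % d             ≡⟨ %-distribˡ-* m n d ⟩
  (m % d * (n % d)) % d   ≡⟨ cong₂ (λ u v → (u * v) % d) eqm eqn ⟩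
  (m′ % d * (n′ % d)) % d ≡⟨ %-distribˡ-* m′ n′ d ⟨
  (m′ * n′) % d           ∎

mod8-reduce : ∀ R K Q S →
  (R * (K * (Q + S))) mod 8 ≡ (toℕ (R mod 8) * (K * (Q + toℕ (S mod 8)))) mod 8
mod8-reduce R K Q S = begin
  (R * (K * (Q + S))) mod 8
    ≡⟨ mod-cong (R * (K * (Q + S))) (R % 8 * (K * (Q + S % 8))) 8
         (%-*-cong R (R % 8) (K * (Q + S)) (K * (Q + S % 8)) 8 (sym (m%n%n≡m%n R 8))
           (%-*-cong K K (Q + S) (Q + S % 8) 8 refl
             (%-+-cong Q Q S (S % 8) 8 refl (sym (m%n%n≡m%n S 8))))) ⟩
  (R % 8 * (K * (Q + S % 8))) mod 8
    ≡⟨ cong₂ (λ r s → (r * (K * (Q + s))) mod 8) (toℕ-mod R 8) (toℕ-mod S 8) ⟨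
  (toℕ (R mod 8) * (K * (Q + toℕ (S mod 8)))) mod 8 ∎

infixl 6 _[_]≔_

_[_]≔_ : ∀ {N} {A : Set} → (Fin N → A) → Fin N → A → Fin N → A
u [ p ]≔ x = updateAt u p (λ _ → x)

imap : ∀ {N} {A B : Set} → (Fin N → A → B) → (Fin N → A) → Fin N → B
imap w u i = w i (u i)

[]≔-congˡ : ∀ {N} {A : Set} {u v : Fin N → A} → u ≗ v → ∀ p x → u [ p ]≔ x ≗ v [ p ]≔ x
[]≔-congˡ u≗v zero    x zero    = refl
[]≔-congˡ u≗v zero    x (suc i) = u≗v (suc i)
[]≔-congˡ u≗v (suc p) x zero    = u≗v zero
[]≔-congˡ u≗v (suc p) x (suc i) = []≔-congˡ (λ j → u≗v (suc j)) p x i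

imap-[]≔ : ∀ {N} {A B : Set} (w : Fin N → A → B) u p x → imap w (u [ p ]≔ x) ≗ imap w u [ p ]≔ w p x
imap-[]≔ w u zero    x zero    = refl
imap-[]≔ w u zero    x (suc i) = refl
imap-[]≔ w u (suc p) x zero    = refl
imap-[]≔ w u (suc p) x (suc i) = imap-[]≔ (λ j → w (suc j)) (λ j → u (suc j)) p x i

imap-[]≔₂ : ∀ {N} {A B : Set} (w : Fin N → A → B) u p q g h →
            imap w (u [ q ]≔ h [ p ]≔ g) ≗ imap w u [ q ]≔ w q h [ p ]≔ w p g
imap-[]≔₂ w u p q g h i =
  trans (imap-[]≔ w (u [ q ]≔ h) p g i) ([]≔-congˡ (imap-[]≔ w u q h) p (w p g) i)

[]≔-id₂ : ∀ {N} {A : Set} (u : Fin N → A) {p q} → p ≢ q → u [ q ]≔ u q [ p ]≔ u p ≗ u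
[]≔-id₂ u {p} {q} p≢q i =
  trans (updateAt-id-local p (u [ q ]≔ u q) (sym (updateAt-minimal p q u p≢q)) i)
        (updateAt-id-local q u refl i)

Σℕ-cong : ∀ N {u v : Fin N → ℕ} → u ≗ v → Σℕ N u ≡ Σℕ N v
Σℕ-cong zero    u≗v = refl
Σℕ-cong (suc N) u≗v = cong₂ _+_ (u≗v zero) (Σℕ-cong N (λ i → u≗v (suc i)))

Πℕ-cong : ∀ N {u v : Fin N → ℕ} → u ≗ v → Πℕ N u ≡ Πℕ N v
Πℕ-cong zero    u≗v = refl
Πℕ-cong (suc N) u≗v = cong₂ _*_ (u≗v zero) (Πℕ-cong N (λ i → u≗v (suc i)))

Σℕ-[]≔ : ∀ N (u : Fin N → ℕ) p x → Σℕ N (u [ p ]≔ x) ≡ x + Σℕ N (u [ p ]≔ 0)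
Σℕ-[]≔ (suc N) u zero    x = refl
Σℕ-[]≔ (suc N) u (suc p) x =
  trans (cong (u zero +_) (Σℕ-[]≔ N (λ i → u (suc i)) p x)) (x+[y+z]≡y+[x+z] (u zero) x _)

Πℕ-[]≔ : ∀ N (u : Fin N → ℕ) p x → Πℕ N (u [ p ]≔ x) ≡ x * Πℕ N (u [ p ]≔ 1)
Πℕ-[]≔ (suc N) u zero    x = cong (x *_) (sym (*-identityˡ _))
Πℕ-[]≔ (suc N) u (suc p) x =
  trans (cong (u zero *_) (Πℕ-[]≔ N (λ i → u (suc i)) p x)) (x*[y*z]≡y*[x*z] (u zero) x _)

module TwoPointUpdate {N} (fold : (Fin N → ℕ) → ℕ) (_∙_ : ℕ → ℕ → ℕ) (ε : ℕ)
                      (fold-cong : ∀ {u v} → u ≗ v → fold u ≡ fold v)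
                      (fold-[]≔ : ∀ u p x → fold (u [ p ]≔ x) ≡ x ∙ fold (u [ p ]≔ ε)) where

  fold-[]≔₂ : ∀ {A : Set} (w : Fin N → A → ℕ) (u : Fin N → A) {p q} → p ≢ q → ∀ g h →
              fold (imap w (u [ q ]≔ h [ p ]≔ g)) ≡ w p g ∙ (w q h ∙ fold (imap w u [ p ]≔ ε [ q ]≔ ε))
  fold-[]≔₂ w u {p} {q} p≢q g h = begin
    fold (imap w (u [ q ]≔ h [ p ]≔ g))             ≡⟨ fold-cong (imap-[]≔₂ w u p q g h) ⟩
    fold (imap w u [ q ]≔ w q h [ p ]≔ w p g)       ≡⟨ fold-[]≔ _ p _ ⟩
    w p g ∙ fold (imap w u [ q ]≔ w q h [ p ]≔ ε)
      ≡⟨ cong (w p g ∙_) (fold-cong (updateAt-commutes p q p≢q (imap w u))) ⟩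
    w p g ∙ fold (imap w u [ p ]≔ ε [ q ]≔ w q h)   ≡⟨ cong (w p g ∙_) (fold-[]≔ _ q _) ⟩
    w p g ∙ (w q h ∙ fold (imap w u [ p ]≔ ε [ q ]≔ ε)) ∎

eval-cong : ∀ {n k} {g g′ : Op n} → (∀ {u u′} → u ≗ u′ → g u ≡ g′ u′) →
            (t : Term n k) {y y′ : Fin k → ℤ₈} → y ≗ y′ → eval g t y ≡ eval g′ t y′
eval-cong g≈g′ (var i)   y≗y′ = y≗y′ i
eval-cong g≈g′ (const a) y≗y′ = refl
eval-cong g≈g′ (add s t) y≗y′ = cong₂ _⊕_ (eval-cong g≈g′ s y≗y′) (eval-cong g≈g′ t y≗y′)
eval-cong g≈g′ (app ts)  y≗y′ = g≈g′ (λ j → eval-cong g≈g′ (ts j) y≗y′)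

-- (m₁ , m₂ , k) stands for the affine form m₁ X + m₂ Y + k.
Affine : Set
Affine = ℕ × ℕ × ℕ

module Combination {T : Set} (_+_ : T → T → T) (κ : ℤ₈ → T) where

  infixr 7 _·_

  _·_ : ℕ → T → T
  zero  · t = κ zero
  suc m · t = t + (m · t)

  affine : Affine → T → T → T
  affine (m₁ , m₂ , k) X Y = (m₁ · X) + ((m₂ · Y) + κ (k mod 8))

  combine : (T → T → T) → List (ℕ × Affine × Affine) → T → T → T
  combine V []                  X Y = κ zero
  combine V ((m , α , β) ∷ cs) X Y = (m · V (affine α X Y) (affine β X Y)) + combine V cs X Y

module Tm {n k : ℕ} = Combination {Term n k} add const
module Z8 = Combination _⊕_ (λ a → a)

module _ {n k} (g : Op n) (y : Fin k → ℤ₈) where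

  private
    ⟦_⟧ : Term n k → ℤ₈
    ⟦ t ⟧ = eval g t y

  eval-· : ∀ m t → ⟦ m Tm.· t ⟧ ≡ m Z8.· ⟦ t ⟧
  eval-· zero    t = refl
  eval-· (suc m) t = cong (⟦ t ⟧ ⊕_) (eval-· m t)

  eval-affine : ∀ α X Y → ⟦ Tm.affine α X Y ⟧ ≡ Z8.affine α ⟦ X ⟧ ⟦ Y ⟧
  eval-affine (m₁ , m₂ , k) X Y = cong₂ _⊕_ (eval-· m₁ X) (cong (_⊕ (k mod 8)) (eval-· m₂ Y))

  eval-combine : (mk : Term n k → Term n k → Term n k) (V : ℤ₈ → ℤ₈ → ℤ₈) →
                 (∀ G H → ⟦ mk G H ⟧ ≡ V ⟦ G ⟧ ⟦ H ⟧) →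
                 ∀ cs X Y → ⟦ Tm.combine mk cs X Y ⟧ ≡ Z8.combine V cs ⟦ X ⟧ ⟦ Y ⟧
  eval-combine mk V mk≈V []                  X Y = refl
  eval-combine mk V mk≈V ((m , α , β) ∷ cs) X Y = cong₂ _⊕_
    (trans (eval-· m _)
           (cong (m Z8.·_) (trans (mk≈V _ _) (cong₂ V (eval-affine α X Y) (eval-affine β X Y)))))
    (eval-combine mk V mk≈V cs X Y)

-- Every two-variable section of f has this shape (fOp-section below).
fSection : (r s : ℤ₈) (aₚ bₚ a_q b_q : Bool) → ℤ₈ → ℤ₈ → ℤ₈
fSection r s aₚ bₚ a_q b_q g h =
  (toℕ r * (2 * G * H * (bit aₚ * (G * G) + bit bₚ * G + bit a_q * (H * H) + bit b_q * H + toℕ s))) mod 8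
  where G = toℕ g
        H = toℕ h

twoWSection : (r : ℤ₈) → ℤ₈ → ℤ₈ → ℤ₈
twoWSection r x y = (toℕ r * (2 * X * Y * (X * X + 1))) mod 8
  where X = toℕ x
        Y = toℕ y

fOp-cong : ∀ N a b c {u v : Fin N → ℤ₈} → u ≗ v → fOp N a b c u ≡ fOp N a b c v
fOp-cong N a b c u≗v = cong₂ (λ P S → (2 * P * S) mod 8)
  (Πℕ-cong N (λ i → cong toℕ (u≗v i)))
  (cong₂ (λ Sa Sb → Sa + Sb + toℕ c)
    (Σℕ-cong N (λ i → cong (λ x → bit (a i) * (toℕ x * toℕ x)) (u≗v i)))
    (Σℕ-cong N (λ i → cong (λ x → bit (b i) * toℕ x) (u≗v i))))

module Sections {N} (a b : Fin N → Bool) (c : Fin 4) {p q : Fin N} (p≢q : p ≢ q) where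

  private
    open TwoPointUpdate (Σℕ N) _+_ 0 (Σℕ-cong N) (Σℕ-[]≔ N) renaming (fold-[]≔₂ to Σℕ-[]≔₂)
    open TwoPointUpdate (Πℕ N) _*_ 1 (Πℕ-cong N) (Πℕ-[]≔ N) renaming (fold-[]≔₂ to Πℕ-[]≔₂)

    valueʷ aʷ bʷ : Fin N → ℤ₈ → ℕ
    valueʷ i x = toℕ x
    aʷ i x = bit (a i) * (toℕ x * toℕ x)
    bʷ i x = bit (b i) * toℕ x

  module _ (y : Fin N → ℤ₈) where

    restProduct restSum : ℕ
    restProduct = Πℕ N (imap valueʷ y [ p ]≔ 1 [ q ]≔ 1)
    restSum     = Σℕ N (imap aʷ y [ p ]≔ 0 [ q ]≔ 0) + Σℕ N (imap bʷ y [ p ]≔ 0 [ q ]≔ 0) + toℕ c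

    fOp-section : ∀ g h → fOp N a b c (y [ q ]≔ h [ p ]≔ g) ≡
                  fSection (restProduct mod 8) (restSum mod 8) (a p) (b p) (a q) (b q) g h
    fOp-section g h = begin
      fOp N a b c (y [ q ]≔ h [ p ]≔ g)
        ≡⟨ cong₂ (λ P S → (2 * P * S) mod 8) (Πℕ-[]≔₂ valueʷ y p≢q g h)
             (cong₂ (λ Sa Sb → Sa + Sb + toℕ c) (Σℕ-[]≔₂ aʷ y p≢q g h) (Σℕ-[]≔₂ bʷ y p≢q g h)) ⟩
      (2 * (G * (H * R)) * ((Aₚ * (G * G) + (A_q * (H * H) + Sa)) + (Bₚ * G + (B_q * H + Sb)) + C)) mod 8
        ≡⟨ cong (_mod 8) (rearrange G H R Aₚ A_q Bₚ B_q Sa Sb C) ⟩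
      (R * (2 * G * H * (Q + restSum))) mod 8
        ≡⟨ mod8-reduce R (2 * G * H) Q restSum ⟩
      fSection (R mod 8) (restSum mod 8) (a p) (b p) (a q) (b q) g h ∎
      where
        G H R Aₚ A_q Bₚ B_q Sa Sb C Q : ℕ
        G = toℕ g
        H = toℕ h
        R = restProduct
        Aₚ = bit (a p)
        A_q = bit (a q)
        Bₚ = bit (b p)
        B_q = bit (b q)
        Sa = Σℕ N (imap aʷ y [ p ]≔ 0 [ q ]≔ 0)
        Sb = Σℕ N (imap bʷ y [ p ]≔ 0 [ q ]≔ 0)
        C = toℕ c
        Q = Aₚ * (G * G) + Bₚ * G + A_q * (H * H) + B_q * H
        rearrange : ∀ G H R Aₚ A_q Bₚ B_q Sa Sb C →
          2 * (G * (H * R)) * ((Aₚ * (G * G) + (A_q * (H * H) + Sa)) + (Bₚ * G + (B_q * H + Sb)) + C) ≡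
          R * (2 * G * H * (Aₚ * (G * G) + Bₚ * G + A_q * (H * H) + B_q * H + (Sa + Sb + C)))
        rearrange = solve 10 (λ G H R Aₚ A_q Bₚ B_q Sa Sb C →
          con 2 :* (G :* (H :* R))
            :* ((Aₚ :* (G :* G) :+ (A_q :* (H :* H) :+ Sa)) :+ (Bₚ :* G :+ (B_q :* H :+ Sb)) :+ C)
          := R :* (con 2 :* G :* H
            :* (Aₚ :* (G :* G) :+ Bₚ :* G :+ A_q :* (H :* H) :+ B_q :* H :+ (Sa :+ Sb :+ C)))) refl

    Πℕ-split : Πℕ N (imap valueʷ y) ≡ toℕ (y p) * (toℕ (y q) * restProduct)
    Πℕ-split = trans (Πℕ-cong N (λ i → cong toℕ (sym ([]≔-id₂ y p≢q i))))
                     (Πℕ-[]≔₂ valueʷ y p≢q (y p) (y q))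

  sectionₜ : Term N N → Term N N → Term N N
  sectionₜ G H = app (var [ q ]≔ H [ p ]≔ G)

  eval-sectionₜ : ∀ y G H → eval (fOp N a b c) (sectionₜ G H) y ≡
    fSection (restProduct y mod 8) (restSum y mod 8) (a p) (b p) (a q) (b q)
             (eval (fOp N a b c) G y) (eval (fOp N a b c) H y)
  eval-sectionₜ y G H =
    trans (fOp-cong N a b c (imap-[]≔₂ (λ _ t → eval (fOp N a b c) t y) var p q G H))
          (fOp-section y _ _)

-- A solution of the linear system over ℤ₈ that expresses r · 2XY(X² + 1) through
-- sections of f at affine arguments, uniformly in r, s, b_p, a_q, b_q.
certificate : List (ℕ × Affine × Affine)
certificate =
  (1 , (2 , 3 , 1) , (0 , 1 , 0)) ∷ (1 , (2 , 3 , 3) , (0 , 1 , 0)) ∷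
  (1 , (3 , 3 , 1) , (0 , 1 , 0)) ∷ (3 , (3 , 3 , 3) , (0 , 1 , 0)) ∷
  (1 , (1 , 0 , 1) , (1 , 0 , 1)) ∷ (1 , (7 , 7 , 1) , (7 , 0 , 1)) ∷
  (3 , (0 , 7 , 1) , (7 , 0 , 1)) ∷ (3 , (0 , 0 , 1) , (7 , 0 , 1)) ∷ []

all-Bool? : {P : Bool → Set} → (∀ x → Dec (P x)) → Dec (∀ x → P x)
all-Bool? P? = map′ (λ (pt , pf) → λ { true → pt ; false → pf }) (λ ∀P → ∀P true , ∀P false)
                    (P? true ×-dec P? false)

combine-certificate : ∀ r s bₚ a_q b_q X Y →
  Z8.combine (fSection r s true bₚ a_q b_q) certificate X Y ≡ twoWSection r X Y
combine-certificate = toWitness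
  {a? = all? λ _ → all? λ _ → all-Bool? λ _ → all-Bool? λ _ → all-Bool? λ _ → all? λ _ → all? λ _ → _ ≟ᶠ _} _

twoW∈C : ∀ {M} (a b : Fin (suc (suc M)) → Bool) (c : Fin 4) (p q j : Fin (suc (suc M))) →
         p ≢ q → a p ≡ true → (p ≡ 0F × q ≡ j) ⊎ (q ≡ 0F × p ≡ j) →
         twoW (suc M) ∈C fOp (suc (suc M)) a b c
twoW∈C {M} a b c p q j p≢q aₚ positions =
  Tm.combine sectionₜ certificate (var 0F) (var j) , correct
  where
    open Sections a b c p≢q
    F = fOp (suc (suc M)) a b c

    Πℕ-split-XY : ∀ y → Πℕ (suc (suc M)) (λ i → toℕ (y i)) ≡ toℕ (y 0F) * (toℕ (y j) * restProduct y)
    Πℕ-split-XY y = trans (Πℕ-split y) (reorder positions)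
      where
        R = restProduct y
        reorder : (p ≡ 0F × q ≡ j) ⊎ (q ≡ 0F × p ≡ j) →
                  toℕ (y p) * (toℕ (y q) * R) ≡ toℕ (y 0F) * (toℕ (y j) * R)
        reorder (inj₁ (p≡0 , q≡j)) = cong₂ (λ u v → toℕ (y u) * (toℕ (y v) * R)) p≡0 q≡j
        reorder (inj₂ (q≡0 , p≡j)) = trans (x*[y*z]≡y*[x*z] (toℕ (y p)) (toℕ (y q)) R)
                                           (cong₂ (λ u v → toℕ (y u) * (toℕ (y v) * R)) q≡0 p≡j)

    correct : ∀ y → eval F (Tm.combine sectionₜ certificate (var 0F) (var j)) y ≡ twoW (suc M) y
    correct y = begin
      eval F (Tm.combine sectionₜ certificate (var 0F) (var j)) y
        ≡⟨ eval-combine F y sectionₜ (fSection r s (a p) (b p) (a q) (b q)) (eval-sectionₜ y) certificate _ _ ⟩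
      Z8.combine (fSection r s (a p) (b p) (a q) (b q)) certificate X Y
        ≡⟨ cong (λ A → Z8.combine (fSection r s A (b p) (a q) (b q)) certificate X Y) aₚ ⟩
      Z8.combine (fSection r s true (b p) (a q) (b q)) certificate X Y
        ≡⟨ combine-certificate r s (b p) (a q) (b q) X Y ⟩
      twoWSection r X Y
        ≡⟨ mod8-reduce R (2 * toℕ X * toℕ Y) (toℕ X * toℕ X) 1 ⟨
      (R * (2 * toℕ X * toℕ Y * (toℕ X * toℕ X + 1))) mod 8
        ≡⟨ cong (_mod 8) (rearrange (toℕ X) (toℕ Y) R) ⟨
      (2 * (toℕ X * (toℕ Y * R)) * (toℕ X * toℕ X + 1)) mod 8
        ≡⟨ cong (λ P → (2 * P * (toℕ X * toℕ X + 1)) mod 8) (Πℕ-split-XY y) ⟨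
      twoW (suc M) y ∎
      where
        X = y 0F
        Y = y j
        R = restProduct y
        r = R mod 8
        s = restSum y mod 8
        rearrange : ∀ X Y R → 2 * (X * (Y * R)) * (X * X + 1) ≡ R * (2 * X * Y * (X * X + 1))
        rearrange = solve 3 (λ X Y R →
          con 2 :* (X :* (Y :* R)) :* (X :* X :+ con 1) := R :* (con 2 :* X :* Y :* (X :* X :+ con 1))) refl

-- For one variable no linear combination of f at affine arguments works uniformly in b
-- and c, hence one term per case.
private
  infixl 6 _+ₜ_

  _+ₜ_ : Term 1 1 → Term 1 1 → Term 1 1
  _+ₜ_ = add

  f⟨_⟩ : Term 1 1 → Term 1 1
  f⟨ t ⟩ = app (λ _ → t)

  xₜ : Term 1 1
  xₜ = var 0F

  ⌜_⌝ : ℕ → Term 1 1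
  ⌜ m ⌝ = const (m mod 8)

unaryTerm : Bool → Fin 4 → Term 1 1
unaryTerm false 0F = f⟨ xₜ ⟩ +ₜ 2 Tm.· xₜ
unaryTerm false 1F = f⟨ xₜ ⟩
unaryTerm false 2F = f⟨ xₜ +ₜ ⌜ 2 ⌝ ⟩ +ₜ 2 Tm.· xₜ
unaryTerm false 3F = f⟨ 2 Tm.· xₜ ⟩ +ₜ f⟨ xₜ ⟩
unaryTerm true  0F = f⟨ xₜ +ₜ ⌜ 1 ⌝ ⟩ +ₜ ⌜ 4 ⌝
unaryTerm true  1F = f⟨ xₜ +ₜ ⌜ 3 ⌝ ⟩ +ₜ 2 Tm.· xₜ +ₜ ⌜ 2 ⌝
unaryTerm true  2F = f⟨ xₜ +ₜ ⌜ 1 ⌝ ⟩ +ₜ 4 Tm.· xₜ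
unaryTerm true  3F = f⟨ xₜ +ₜ ⌜ 1 ⌝ ⟩ +ₜ 2 Tm.· xₜ +ₜ ⌜ 6 ⌝

unaryTerm-correct : ∀ b₀ c v →
  eval (fOp 1 (λ _ → true) (λ _ → b₀) c) (unaryTerm b₀ c) (λ _ → v) ≡ twoW 0 (λ _ → v)
unaryTerm-correct = toWitness {a? = all-Bool? λ _ → all? λ _ → all? λ _ → _ ≟ᶠ _} _

twoW∈C-unary : (a b : Fin 1 → Bool) (c : Fin 4) → a 0F ≡ true → twoW 0 ∈C fOp 1 a b c
twoW∈C-unary a b c a₀ = unaryTerm (b 0F) c , λ y →
  trans (eval-cong unary-form (unaryTerm (b 0F) c) (λ { 0F → refl })) (unaryTerm-correct (b 0F) c (y 0F))
  where
    unary-form : ∀ {u u′} → u ≗ u′ → fOp 1 a b c u ≡ fOp 1 (λ _ → true) (λ _ → b 0F) c u′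
    unary-form u≗u′ = cong₂ (λ A v → fOp 1 (λ _ → A) (λ _ → b 0F) c (λ _ → v)) a₀ (u≗u′ 0F)

lemma4p4 : (n : ℕ) (a b : Fin (suc n) → Bool) (c : Fin 4) →
    Σ (Fin (suc n)) (λ i → a i ≡ true) →
    (twoW n ∈C fOp (suc n) a b c) ⊎ (twoQ n ∈C fOp (suc n) a b c)
lemma4p4 zero    a b c (0F , a₀)    = inj₁ (twoW∈C-unary a b c a₀)
lemma4p4 (suc M) a b c (0F , a₀)    = inj₁ (twoW∈C a b c 0F 1F 1F (λ ()) a₀ (inj₁ (refl , refl)))
lemma4p4 (suc M) a b c (suc i , aᵢ) = inj₁ (twoW∈C a b c (suc i) 0F (suc i) (λ ()) aᵢ (inj₂ (refl , refl)))
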